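{- Let $G=(V,E)$ be a graph and $k\ge 0$ an integer such that $(G,k)$ is a yes-instance of \textsc{Trivially Perfect Editing}. Let $M\subseteq V$ be a module of $G$ such that $G[M]$ contains an anti-matching of size $k+1$. Let $F$ be any $k$-editing of $G$ and $H=G\triangle F$. Then $N_G(M)$ is a clique in $H$.
   Context: Graphs are finite, simple, undirected. A graph is trivially perfect if it has no induced $C_4$ and no induced $P_4$. For $F\subseteq[V]^2$, $G\triangle F=(V,E\triangle F)$. A $k$-editing of $G$ is a set $F\subseteq[V]^2$ with $|F|\le k$ such that $G\triangle F$ is trivially perfect; $(G,k)$ is a yes-instance of \textsc{Trivially Perfect Editing} if a $k$-editing exists. A module of $G$ is a set $M\subseteq V$ such that $N(u)\setminus M=N(v)\setminus M$ for all $u,v\in M$. $N_G(M)=\bigcup_{v\in M}N_G(v)\setminus M$. An anti-matching is a set of pairwise disjoint pairs $\{u,v\}$ of vertices with $\{u,v\}\notin E$; its size is the number of pairs. -}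

module Defs where

open import Data.Nat using (ℕ; _≤_; suc)
open import Data.Bool using (Bool; true; false; _xor_)
import Data.Bool as B
open import Data.Fin using (Fin; _<?_)
open import Data.List using (List; length; filter; allFin; concatMap; map)
open import Data.Product using (_×_; _,_; proj₁; proj₂; ∃)
open import Relation.Nullary using (¬_)
open import Relation.Binary.PropositionalEquality using (_≡_; _≢_; cong₂; refl)

record Graph (n : ℕ) : Set where
  field
    adj   : Fin n → Fin n → Bool
    sym   : ∀ u v → adj u v ≡ adj v u
    irref : ∀ v → adj v v ≡ false
open Graph public

Adj : ∀ {n} → Graph n → Fin n → Fin n → Set
Adj G u v = adj G u v ≡ true

NonAdj : ∀ {n} → Graph n → Fin n → Fin n → Set
NonAdj G u v = adj G u v ≡ false

-- A set F ⊆ [V]^2 of unordered vertex pairs, encoded as a symmetric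
-- irreflexive Boolean function (F u v = true iff {u,v} ∈ F).
PairSet : ℕ → Set
PairSet = Graph

size : ∀ {n} → PairSet n → ℕ
size {n} F =
  length (filter (λ p → adj F (proj₁ p) (proj₂ p) B.≟ true)
           (concatMap (λ u → map (λ v → (u , v))
              (filter (λ v → u <? v) (allFin n))) (allFin n)))

xor-false : ∀ b → b xor b ≡ false
xor-false true = refl
xor-false false = refl

_△_ : ∀ {n} → Graph n → PairSet n → Graph n
G △ F = record
  { adj   = λ u v → adj G u v xor adj F u v
  ; sym   = λ u v → cong₂ _xor_ (sym G u v) (sym F u v)
  ; irref = λ v → cong₂ _xor_ (irref G v) (irref F v) }

InducedP4 : ∀ {n} → Graph n → Fin n → Fin n → Fin n → Fin n → Set
InducedP4 G a b c d =
  a ≢ b × a ≢ c × a ≢ d × b ≢ c × b ≢ d × c ≢ d ×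
  Adj G a b × Adj G b c × Adj G c d ×
  NonAdj G a c × NonAdj G a d × NonAdj G b d

InducedC4 : ∀ {n} → Graph n → Fin n → Fin n → Fin n → Fin n → Set
InducedC4 G a b c d =
  a ≢ b × a ≢ c × a ≢ d × b ≢ c × b ≢ d × c ≢ d ×
  Adj G a b × Adj G b c × Adj G c d × Adj G d a ×
  NonAdj G a c × NonAdj G b d

TriviallyPerfect : ∀ {n} → Graph n → Set
TriviallyPerfect G = ∀ a b c d → ¬ InducedP4 G a b c d × ¬ InducedC4 G a b c d

IsEditing : ∀ {n} → Graph n → ℕ → PairSet n → Set
IsEditing G k F = size F ≤ k × TriviallyPerfect (G △ F)

YesInstance : ∀ {n} → Graph n → ℕ → Set
YesInstance G k = ∃ λ F → IsEditing G k F

Subset : ℕ → Set₁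
Subset n = Fin n → Set

IsModule : ∀ {n} → Graph n → Subset n → Set
IsModule G M = ∀ u v → M u → M v → ∀ w → ¬ M w → adj G u w ≡ adj G v w

NeighM : ∀ {n} → Graph n → Subset n → Subset n
NeighM G M w = ∃ (λ v → M v × Adj G v w) × ¬ M w

AntiMatchingIn : ∀ {n} → Graph n → Subset n → ℕ → Set
AntiMatchingIn {n} G M m =
  ∃ λ (u : Fin m → Fin n) → ∃ λ (v : Fin m → Fin n) →
    (∀ i → M (u i) × M (v i) × NonAdj G (u i) (v i)) ×
    (∀ i → u i ≢ v i) ×
    (∀ i j → i ≢ j → u i ≢ u j × u i ≢ v j × v i ≢ v j)

IsClique : ∀ {n} → Graph n → Subset n → Set
IsClique H S = ∀ x y → S x → S y → x ≢ y → Adj H x y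

-- Suppose x, y ∈ N_G(M) are distinct but nonadjacent in H = G △ F.  Since M
-- is a module, x and y are adjacent in G to every vertex of M.  For each pair
-- {u, v} of the anti-matching, if F contained none of xu, xv, yu, yv, uv then
-- x u y v would be an induced C4 of H; so F contains a pair with an endpoint
-- in {u, v} and the other in {x, y, u, v}.  These k + 1 pairs are distinct,
-- because the anti-matching pairs are disjoint and x, y ∉ M, so |F| ≥ k + 1.
module Submission where

open import Defs
open import Data.Nat using (ℕ; suc; _≤_)
open import Data.Nat.Properties using (1+n≰n; ≤-trans)
open import Data.Bool as B using (true; false)
open import Data.Fin using (Fin; _<?_; _<_)
open import Data.Fin.Properties using (injective⇒≤; <-cmp) renaming (_≟_ to _≟ᶠ_)
open import Data.List using (List; length; filter; allFin; concatMap; map; lookup)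
open import Data.List.Relation.Unary.Any using (index)
open import Data.List.Relation.Unary.Any.Properties using (lookup-index)
open import Data.List.Membership.Propositional using (_∈_; lose)
open import Data.List.Membership.Propositional.Properties
  using (∈-filter⁺; ∈-concatMap⁺; ∈-allFin; ∈-map⁺)
open import Data.Product using (_×_; _,_; proj₁; proj₂; ∃; ∃₂)
open import Data.Sum using (_⊎_; inj₁; inj₂)
open import Data.Empty using (⊥-elim)
open import Function using (_∘_)
open import Function.Definitions using (Injective)
open import Relation.Nullary using (¬_; yes; no)
open import Relation.Binary using (tri<; tri≈; tri>)
open import Relation.Binary.PropositionalEquality
  using (_≡_; _≢_; ≢-sym; refl; trans; cong; subst; module ≡-Reasoning) renaming (sym to ≡-sym)

private
  variable
    n m : ℕ

Endpoint : Fin n → Fin n × Fin n → Set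
Endpoint c (a , b) = c ≡ a ⊎ c ≡ b

endpoint-swap : ∀ {c a b : Fin n} → Endpoint c (a , b) → Endpoint c (b , a)
endpoint-swap (inj₁ c≡a) = inj₂ c≡a
endpoint-swap (inj₂ c≡b) = inj₁ c≡b

length-≥-injection : ∀ {A : Set} {xs : List A} (f : Fin m → A) →
  Injective _≡_ _≡_ f → (∀ i → f i ∈ xs) → m ≤ length xs
length-≥-injection {xs = xs} f f-inj f∈xs = injective⇒≤ (f-inj ∘ same-lookup)
  where
  open ≡-Reasoning
  same-lookup : ∀ {i j} → index (f∈xs i) ≡ index (f∈xs j) → f i ≡ f j
  same-lookup {i} {j} eq = begin
    f i                          ≡⟨ lookup-index (f∈xs i) ⟩
    lookup xs (index (f∈xs i))   ≡⟨ cong (lookup xs) eq ⟩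
    lookup xs (index (f∈xs j))   ≡⟨ ≡-sym (lookup-index (f∈xs j)) ⟩
    f j                          ∎

edgeList : PairSet n → List (Fin n × Fin n)
edgeList {n} F =
  filter (λ p → adj F (proj₁ p) (proj₂ p) B.≟ true)
    (concatMap (λ u → map (λ v → (u , v)) (filter (λ v → u <? v) (allFin n)))
      (allFin n))

∈-edgeList : (F : PairSet n) {u v : Fin n} → u < v → Adj F u v → (u , v) ∈ edgeList F
∈-edgeList F {u} {v} u<v uFv =
  ∈-filter⁺ _ (∈-concatMap⁺ _ (lose (∈-allFin u)
                 (∈-map⁺ (u ,_) (∈-filter⁺ (u <?_) (∈-allFin v) u<v))))
            uFv

orient : (a b : Fin n) → a ≢ b →
  ∃ λ q → proj₁ q < proj₂ q × (q ≡ (a , b) ⊎ q ≡ (b , a))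
orient a b a≢b with <-cmp a b
... | tri< a<b _ _ = (a , b) , a<b , inj₁ refl
... | tri≈ _ a≡b _ = ⊥-elim (a≢b a≡b)
... | tri> _ _ b<a = (b , a) , b<a , inj₂ refl

-- The private endpoint a i tells the pairs apart, so their sorted forms are
-- distinct entries of edgeList F.
size-≥-privateEndpoints : (F : PairSet n) (a b : Fin m → Fin n) →
  (∀ i → a i ≢ b i) → (∀ i → Adj F (a i) (b i)) →
  (∀ i j → i ≢ j → ¬ Endpoint (a i) (a j , b j)) →
  m ≤ size F
size-≥-privateEndpoints F a b a≢b aFb private-a =
  length-≥-injection (proj₁ ∘ oriented) oriented-injective oriented∈edgeList
  where
  oriented : ∀ i → ∃ λ q → proj₁ q < proj₂ q × (q ≡ (a i , b i) ⊎ q ≡ (b i , a i))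
  oriented i = orient (a i) (b i) (a≢b i)

  oriented∈edgeList : ∀ i → proj₁ (oriented i) ∈ edgeList F
  oriented∈edgeList i with oriented i
  ... | _ , lt , inj₁ refl = ∈-edgeList F lt (aFb i)
  ... | _ , lt , inj₂ refl = ∈-edgeList F lt (trans (sym F (b i) (a i)) (aFb i))

  a∈oriented : ∀ i → Endpoint (a i) (proj₁ (oriented i))
  a∈oriented i with oriented i
  ... | _ , _ , inj₁ refl = inj₁ refl
  ... | _ , _ , inj₂ refl = inj₂ refl

  oriented-endpoint : ∀ {c} i → Endpoint c (proj₁ (oriented i)) → Endpoint c (a i , b i)
  oriented-endpoint i with oriented i
  ... | _ , _ , inj₁ refl = λ e → e
  ... | _ , _ , inj₂ refl = endpoint-swap

  oriented-injective : Injective _≡_ _≡_ (proj₁ ∘ oriented)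
  oriented-injective {i} {j} qᵢ≡qⱼ with i ≟ᶠ j
  ... | yes i≡j = i≡j
  ... | no i≢j = ⊥-elim (private-a i j i≢j
        (oriented-endpoint j (subst (Endpoint (a i)) qᵢ≡qⱼ (a∈oriented i))))

adj-sym : (G : Graph n) {a b : Fin n} → Adj G a b → Adj G b a
adj-sym G {a} {b} e = trans (sym G b a) e

nonAdj-sym : (G : Graph n) {a b : Fin n} → NonAdj G a b → NonAdj G b a
nonAdj-sym G {a} {b} e = trans (sym G b a) e

adj⇒≢ : (G : Graph n) {a b : Fin n} → Adj G a b → a ≢ b
adj⇒≢ G {a} e refl with () ← trans (≡-sym e) (irref G a)

adj? : (G : Graph n) (a b : Fin n) → Adj G a b ⊎ NonAdj G a b
adj? G a b with adj G a b
... | true  = inj₁ refl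
... | false = inj₂ refl

△-adj : (G F : Graph n) {a b : Fin n} → Adj G a b → NonAdj F a b → Adj (G △ F) a b
△-adj G F aGb aF̸b rewrite aGb | aF̸b = refl

△-nonAdj : (G F : Graph n) {a b : Fin n} → NonAdj G a b → NonAdj F a b → NonAdj (G △ F) a b
△-nonAdj G F aG̸b aF̸b rewrite aG̸b | aF̸b = refl

module-neighbour-complete : (G : Graph n) {M : Subset n} → IsModule G M →
  ∀ {x w} → NeighM G M x → M w → Adj G x w
module-neighbour-complete G modM {x} {w} ((v , Mv , vGx) , ¬Mx) Mw =
  trans (sym G x w) (trans (modM w v Mw Mv x ¬Mx) vGx)

SquareEdit : PairSet n → Fin n × Fin n → Fin n × Fin n → Set
SquareEdit F xy uv = ∃₂ λ a b → Endpoint a uv × (Endpoint b xy ⊎ Endpoint b uv) × Adj F a b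

editing-hits-square : (G F : Graph n) → TriviallyPerfect (G △ F) → {x y u v : Fin n} →
  x ≢ u → x ≢ y → x ≢ v → u ≢ y → u ≢ v → y ≢ v →
  Adj G x u → Adj G x v → Adj G y u → Adj G y v →
  NonAdj G u v → NonAdj (G △ F) x y → SquareEdit F (x , y) (u , v)
editing-hits-square G F tp {x} {y} {u} {v} x≢u x≢y x≢v u≢y u≢v y≢v xu xv yu yv u≁v x≁y
  with adj? F u x | adj? F u y | adj? F v x | adj? F v y | adj? F u v
... | inj₁ ux | _       | _       | _       | _      = u , x , inj₁ refl , inj₁ (inj₁ refl) , ux
... | inj₂ _  | inj₁ uy | _       | _       | _      = u , y , inj₁ refl , inj₁ (inj₂ refl) , uy
... | inj₂ _  | inj₂ _  | inj₁ vx | _       | _      = v , x , inj₂ refl , inj₁ (inj₁ refl) , vx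
... | inj₂ _  | inj₂ _  | inj₂ _  | inj₁ vy | _      = v , y , inj₂ refl , inj₁ (inj₂ refl) , vy
... | inj₂ _  | inj₂ _  | inj₂ _  | inj₂ _  | inj₁ uv = u , v , inj₁ refl , inj₂ (inj₂ refl) , uv
... | inj₂ ux | inj₂ uy | inj₂ vx | inj₂ vy | inj₂ uv = ⊥-elim (proj₂ (tp x u y v)
      ( x≢u , x≢y , x≢v , u≢y , u≢v , y≢v
      , △-adj G F xu (nonAdj-sym F ux) , △-adj G F (adj-sym G yu) uy
      , △-adj G F yv (nonAdj-sym F vy) , △-adj G F (adj-sym G xv) vx
      , x≁y , △-nonAdj G F u≁v uv ))

antiMatching-disjoint : {u v : Fin m → Fin n} →
  (∀ i j → i ≢ j → u i ≢ u j × u i ≢ v j × v i ≢ v j) →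
  ∀ {i j c} → i ≢ j → Endpoint c (u i , v i) → ¬ Endpoint c (u j , v j)
antiMatching-disjoint disjoint {i} {j} i≢j (inj₁ c≡uᵢ) (inj₁ c≡uⱼ) =
  proj₁ (disjoint i j i≢j) (trans (≡-sym c≡uᵢ) c≡uⱼ)
antiMatching-disjoint disjoint {i} {j} i≢j (inj₁ c≡uᵢ) (inj₂ c≡vⱼ) =
  proj₁ (proj₂ (disjoint i j i≢j)) (trans (≡-sym c≡uᵢ) c≡vⱼ)
antiMatching-disjoint disjoint {i} {j} i≢j (inj₂ c≡vᵢ) (inj₁ c≡uⱼ) =
  proj₁ (proj₂ (disjoint j i (≢-sym i≢j))) (trans (≡-sym c≡uⱼ) c≡vᵢ)
antiMatching-disjoint disjoint {i} {j} i≢j (inj₂ c≡vᵢ) (inj₂ c≡vⱼ) =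
  proj₂ (proj₂ (disjoint i j i≢j)) (trans (≡-sym c≡vᵢ) c≡vⱼ)

module _ (G : Graph n) {M : Subset n} (modM : IsModule G M)
         (F : PairSet n) (tp : TriviallyPerfect (G △ F))
         {x y : Fin n} (Nx : NeighM G M x) (Ny : NeighM G M y)
         (x≢y : x ≢ y) (x≁y : NonAdj (G △ F) x y) where

  private
    outside : ∀ {c w} → ¬ M c → M w → c ≢ w
    outside ¬Mc Mw refl = ¬Mc Mw

    ¬Mx : ¬ M x
    ¬Mx = proj₂ Nx

    ¬My : ¬ M y
    ¬My = proj₂ Ny

  antiEdge-forces-edit : ∀ {u v} → M u → M v → u ≢ v → NonAdj G u v →
    SquareEdit F (x , y) (u , v)
  antiEdge-forces-edit Mu Mv u≢v u≁v = editing-hits-square G F tp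
    (outside ¬Mx Mu) x≢y (outside ¬Mx Mv) (≢-sym (outside ¬My Mu)) u≢v (outside ¬My Mv)
    (complete Nx Mu) (complete Nx Mv) (complete Ny Mu) (complete Ny Mv) u≁v x≁y
    where complete = module-neighbour-complete G modM

  antiMatching⇒≤size : AntiMatchingIn G M m → m ≤ size F
  antiMatching⇒≤size {m} (u , v , antiEdge , u≢v , disjoint) =
    size-≥-privateEndpoints F a b (λ i → adj⇒≢ F (aFb i)) aFb private-a
    where
    edit : ∀ i → SquareEdit F (x , y) (u i , v i)
    edit i = let (Mu , Mv , u≁v) = antiEdge i in antiEdge-forces-edit Mu Mv (u≢v i) u≁v

    a b : Fin m → Fin n
    a i = proj₁ (edit i)
    b i = proj₁ (proj₂ (edit i))

    a∈uv : ∀ i → Endpoint (a i) (u i , v i)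
    a∈uv i = proj₁ (proj₂ (proj₂ (edit i)))

    aFb : ∀ i → Adj F (a i) (b i)
    aFb i = proj₂ (proj₂ (proj₂ (proj₂ (edit i))))

    ∈M : ∀ {c} i → Endpoint c (u i , v i) → M c
    ∈M i (inj₁ refl) = proj₁ (antiEdge i)
    ∈M i (inj₂ refl) = proj₁ (proj₂ (antiEdge i))

    ∉M : ∀ {c} → Endpoint c (x , y) → ¬ M c
    ∉M (inj₁ refl) = ¬Mx
    ∉M (inj₂ refl) = ¬My

    private-a : ∀ i j → i ≢ j → ¬ Endpoint (a i) (a j , b j)
    private-a i j i≢j (inj₁ aᵢ≡aⱼ) =
      antiMatching-disjoint disjoint i≢j (a∈uv i)
        (subst (λ c → Endpoint c _) (≡-sym aᵢ≡aⱼ) (a∈uv j))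
    private-a i j i≢j (inj₂ aᵢ≡bⱼ) with proj₁ (proj₂ (proj₂ (proj₂ (edit j))))
    ... | inj₁ b∈xy = ∉M b∈xy (subst M aᵢ≡bⱼ (∈M i (a∈uv i)))
    ... | inj₂ b∈uv = antiMatching-disjoint disjoint i≢j (a∈uv i)
                        (subst (λ c → Endpoint c _) (≡-sym aᵢ≡bⱼ) b∈uv)

mainTheorem4 : ∀ {n} (G : Graph n) (k : ℕ) → YesInstance G k →
    (M : Subset n) → IsModule G M → AntiMatchingIn G M (suc k) →
    (F : PairSet n) → IsEditing G k F →
    IsClique (G △ F) (NeighM G M)
mainTheorem4 G k _ M modM am F (size≤k , tp) x y Nx Ny x≢y with adj? (G △ F) x y
... | inj₁ x~y = x~y
... | inj₂ x≁y =
  ⊥-elim (1+n≰n (≤-trans (antiMatching⇒≤size G modM F tp Nx Ny x≢y x≁y am) size≤k))
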